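{- Let $w$ be a prefix of the Kolakoski sequence $S$ with $|w|\ge 2$, and let $b_k$ ($k=1,2,\dots$) be the blocks generated by $w$. Suppose that $f_\infty(1)=\lim_{n\to\infty}\frac{|s_1\cdots s_n|_1}{n}$ exists. Then for every $\varepsilon>0$ there is an integer $n$ such that $|f_{b_k}(1)-f_\infty(1)|<\varepsilon$ for every $k\ge n$.
   Context: Words are over the alphabet $\{1,2\}$; $|v|$ is the length of $v$, $|v|_x$ the number of occurrences of the letter $x$ in $v$, and $f_v(x)=|v|_x/|v|$ for nonempty $v$. For a finite or infinite word $v=a_1a_2\cdots$, its integral $v^{ -1}$ is obtained by replacing each letter $a_i$ by $a_i$ copies of the letter $1$ if $i$ is odd and by $a_i$ copies of the letter $2$ if $i$ is even. Set $v^0=v$, $v^{ -k}=(v^{ -(k-1)})^{ -1}$. The Kolakoski sequence $S=s_1s_2\cdots=1221121221\cdots$ is the unique infinite word over $\{1,2\}$ with $S^{ -1}=S$; if $w$ is a prefix of $S$ then so is $w^{ -k}$ for all $k\ge0$. For a prefix $w$ of $S$ with $|w|>1$ and each positive integer $k$, the $k$-th block generated by $w$ is the unique word $b_k$ with $w^{ -k+1}b_k=w^{ -k}$; thus $S=wb_1b_2b_3\cdots$. -}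

module Defs where

open import Data.Nat using (_∸_; ℕ; zero; suc; _≤_)
open import Data.Bool using (Bool; true; false; not)
open import Data.List using (drop; List; []; _∷_; _++_; replicate; length; _∷ʳ_)
open import Data.Integer using (+_)
open import Data.Rational using (ℚ; 0ℚ; _/_; _-_; ∣_∣; _<_)
open import Data.Product using (∃-syntax; _×_)
open import Relation.Binary.PropositionalEquality using (_≡_)

data Letter : Set where
  ₁ ₂ : Letter

val : Letter → ℕ
val ₁ = 1
val ₂ = 2

-- Integral of a finite word; the Bool records whether the current position is odd.
integAux : Bool → List Letter → List Letter
integAux b [] = []
integAux true  (a ∷ v) = replicate (val a) ₁ ++ integAux false v
integAux false (a ∷ v) = replicate (val a) ₂ ++ integAux true v

integ : List Letter → List Letter
integ = integAux true

integPow : ℕ → List Letter → List Letter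
integPow zero    v = v
integPow (suc k) v = integ (integPow k v)

-- Infinite words are functions ℕ → Letter (index 0 is s_1).
-- prefixOf S n = s_1 ⋯ s_n
prefixOf : (ℕ → Letter) → ℕ → List Letter
prefixOf S zero    = []
prefixOf S (suc n) = prefixOf S n ∷ʳ S n

IsPrefix : List Letter → (ℕ → Letter) → Set
IsPrefix p S = p ≡ prefixOf S (length p)

-- S^{-1} = S, unfolded: the integral of every finite prefix of S is a prefix of S
-- (S^{-1} is the union of the integrals of the prefixes of S).
IsKolakoski : (ℕ → Letter) → Set
IsKolakoski S = ∀ n → IsPrefix (integ (prefixOf S n)) S

count₁ : List Letter → ℕ
count₁ [] = 0
count₁ (₁ ∷ v) = suc (count₁ v)
count₁ (₂ ∷ v) = count₁ v

frac : ℕ → ℕ → ℚ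
frac a zero    = 0ℚ
frac a (suc n) = (+ a) / suc n

-- f_v(1) = |v|_1 / |v|  (convention: 0 for the empty word; only used for nonempty v)
freq₁ : List Letter → ℚ
freq₁ v = frac (count₁ v) (length v)

-- b_k generated by w, defined by  w^{-k+1} b_k = w^{-k}  (for k ≥ 1)
block : List Letter → ℕ → List Letter
block w k = drop (length (integPow (k ∸ 1) w)) (integPow k w)

-- f_∞(1) = lim |s_1⋯s_n|_1 / n exists (Cauchy criterion over ℚ; ℝ is complete)
FreqLimitExists : (ℕ → Letter) → Set
FreqLimitExists S =
  ∀ (ε : ℚ) → 0ℚ < ε → ∃[ N ] (∀ m n → N ≤ m → N ≤ n → 1 ≤ m → 1 ≤ n →
    ∣ freq₁ (prefixOf S m) - freq₁ (prefixOf S n) ∣ < ε)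

-- Every iterated integral w^{-k} of w is a prefix of S, and the block b_{k+1} is the
-- factor of S between positions |w^{-k}| and |w^{-(k+1)}| = |w^{-k}| + |w^{-k}|_2.  An integral
-- v^{-1} has at most 3|v^{-1}|_2 + 2 letters, so |w^{-k}| ≤ 5|b_{k+1}| once k ≥ 1: each block is
-- long compared with the prefix in front of it.  If the prefix frequencies of lengths
-- a and a + d are both δ-close to a value L and a ≤ 5d, then the frequency of the factor between
-- them is 11δ-close to L, and the Cauchy property of the prefix frequencies finishes the proof.
module Submission where

open import Defs
open import Data.Nat using (ℕ; suc; _≤_)
open import Data.List using (List; length)
open import Data.Rational using (ℚ; 0ℚ; _-_; ∣_∣; _<_)
open import Data.Product using (∃-syntax; _,_)
open import Data.Rational.Properties using (≤-<-trans)
open import Relation.Binary.PropositionalEquality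

module Frequency where
  open import Data.Nat as ℕ using (ℕ; suc)
  import Data.Nat.Properties as ℕ
  open import Data.Integer as ℤ using (+_)
  import Data.Integer.Properties as ℤ
  open import Data.Rational as ℚ hiding (_≤_)
  open import Data.Rational.Properties
  import Data.Rational.Unnormalised as ℚᵘ
  import Data.Rational.Unnormalised.Properties as ℚᵘ
  open import Relation.Nullary.Decidable using (toWitness)
  open import Data.Product using (_×_)
  open import Data.Nat.Coprimality using (1-coprimeTo) renaming (sym to coprime-sym)
  open import Data.Rational.Solver using () renaming (module +-*-Solver to ℚ-Solver)
  open import Data.Nat.Solver using () renaming (module +-*-Solver to ℕ-Solver)

  ι : ℕ → ℚ
  ι n = mkℚ (+ n) 0 (coprime-sym (1-coprimeTo n))

  ι-+ : ∀ a b → ι (a ℕ.+ b) ≡ ι a + ι b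
  ι-+ a b = toℚᵘ-injective (ℚᵘ.≃-sym (ℚᵘ.≃-trans (toℚᵘ-homo-+ (ι a) (ι b)) (ℚᵘ.*≡* eq)))
    where
    eq : (+ a ℤ.* + 1 ℤ.+ + b ℤ.* + 1) ℤ.* + 1 ≡ + (a ℕ.+ b) ℤ.* + 1
    eq = cong (ℤ._* + 1) (trans (cong₂ ℤ._+_ (ℤ.*-identityʳ (+ a)) (ℤ.*-identityʳ (+ b)))
                                (sym (ℤ.pos-+ a b)))

  ι-* : ∀ a b → ι (a ℕ.* b) ≡ ι a * ι b
  ι-* a b = toℚᵘ-injective (ℚᵘ.≃-sym (ℚᵘ.≃-trans (toℚᵘ-homo-* (ι a) (ι b))
                                                   (ℚᵘ.*≡* (cong (ℤ._* + 1) (sym (ℤ.pos-* a b))))))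

  ι-mono-≤ : ∀ {a b} → a ℕ.≤ b → ι a ℚ.≤ ι b
  ι-mono-≤ {a} {b} a≤b =
    *≤* (subst₂ ℤ._≤_ (sym (ℤ.*-identityʳ (+ a))) (sym (ℤ.*-identityʳ (+ b))) (ℤ.+≤+ a≤b))

  frac-*-denominator : ∀ c n → frac c (suc n) * ι (suc n) ≡ ι c
  frac-*-denominator c n = toℚᵘ-injective (ℚᵘ.≃-trans (toℚᵘ-homo-* (frac c (suc n)) (ι (suc n)))
    (ℚᵘ.≃-trans (ℚᵘ.*-congʳ (toℚᵘ-fromℚᵘ (ℚᵘ.mkℚᵘ (+ c) n))) (ℚᵘ.*≡* eq)))
    where
    eq : (+ c ℤ.* + suc n) ℤ.* + 1 ≡ + c ℤ.* + suc (n ℕ.* 1)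
    eq = trans (ℤ.*-identityʳ _) (cong (λ k → + c ℤ.* + suc k) (sym (ℕ.*-identityʳ n)))

  weighted-deviation : ∀ c n L → (frac c (suc n) - L) * ι (suc n) ≡ ι c - L * ι (suc n)
  weighted-deviation c n L = begin
    (frac c (suc n) - L) * ι (suc n)         ≡⟨ distrib (frac c (suc n)) L (ι (suc n)) ⟩
    frac c (suc n) * ι (suc n) - L * ι (suc n) ≡⟨ cong (_- L * ι (suc n)) (frac-*-denominator c n) ⟩
    ι c - L * ι (suc n)                          ∎
    where
    open ≡-Reasoning
    open ℚ-Solver
    distrib : ∀ f L D → (f - L) * D ≡ f * D - L * D
    distrib = solve 3 (λ f L D → (f :- L) :* D := f :* D :- L :* D) refl

  frac-deviation-telescope : ∀ x z a d L →
    (frac z (suc d) - L) * ι (suc d) ≡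
      (frac (x ℕ.+ z) (suc a ℕ.+ suc d) - L) * ι (suc a ℕ.+ suc d) - (frac x (suc a) - L) * ι (suc a)
  frac-deviation-telescope x z a d L = begin
    (frac z (suc d) - L) * D                     ≡⟨ weighted-deviation z d L ⟩
    ι z - L * D                                    ≡⟨ telescope (ι x) (ι z) L A D ⟩
    (ι x + ι z) - L * (A + D) - (ι x - L * A)
      ≡⟨ cong₂ (λ p q → p - L * q - (ι x - L * A)) (sym (ι-+ x z)) (sym (ι-+ (suc a) (suc d))) ⟩
    ι (x ℕ.+ z) - L * ι (suc a ℕ.+ suc d) - (ι x - L * A)
      ≡⟨ sym (cong₂ _-_ (weighted-deviation (x ℕ.+ z) (a ℕ.+ suc d) L) (weighted-deviation x a L)) ⟩
    (frac (x ℕ.+ z) (suc a ℕ.+ suc d) - L) * ι (suc a ℕ.+ suc d) - (frac x (suc a) - L) * A ∎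
    where
    open ≡-Reasoning
    A = ι (suc a)
    D = ι (suc d)
    open ℚ-Solver
    telescope : ∀ X Z L A D → Z - L * D ≡ (X + Z) - L * (A + D) - (X - L * A)
    telescope = solve 5 (λ X Z L A D → Z :- L :* D := (X :+ Z) :- L :* (A :+ D) :- (X :- L :* A)) refl

  twice-plus-≤ : ∀ {A D} c → A ℕ.≤ c ℕ.* D → A ℕ.+ D ℕ.+ A ℕ.≤ (2 ℕ.* c ℕ.+ 1) ℕ.* D
  twice-plus-≤ {A} {D} c A≤cD =
    ℕ.≤-trans (ℕ.+-mono-≤ (ℕ.+-monoˡ-≤ D A≤cD) A≤cD) (ℕ.≤-reflexive (identity c D))
    where
    open ℕ-Solver
    identity : ∀ c D → c ℕ.* D ℕ.+ D ℕ.+ c ℕ.* D ≡ (2 ℕ.* c ℕ.+ 1) ℕ.* D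
    identity = solve 2 (λ c D → c :* D :+ D :+ c :* D := (con 2 :* c :+ con 1) :* D) refl

  frac-deviation-≤ : ∀ {x z a d L δ} c → suc a ℕ.≤ c ℕ.* suc d →
    ∣ frac (x ℕ.+ z) (suc a ℕ.+ suc d) - L ∣ < δ → ∣ frac x (suc a) - L ∣ < δ →
    ∣ frac z (suc d) - L ∣ ℚ.≤ δ * ι (2 ℕ.* c ℕ.+ 1)
  frac-deviation-≤ {x} {z} {a} {d} {L} {δ} c a≤cd close-a+d close-a = *-cancelʳ-≤-pos D (begin
    ∣ frac z (suc d) - L ∣ * D             ≡⟨ ∣p*q∣≡∣p∣*∣q∣ (frac z (suc d) - L) D ⟨
    ∣ (frac z (suc d) - L) * D ∣           ≡⟨ cong ∣_∣ (frac-deviation-telescope x z a d L) ⟩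
    ∣ u * AD - v * A ∣                     ≤⟨ ∣p-q∣≤∣p∣+∣q∣ (u * AD) (v * A) ⟩
    ∣ u * AD ∣ + ∣ v * A ∣                 ≡⟨ cong₂ _+_ (∣p*q∣≡∣p∣*∣q∣ u AD) (∣p*q∣≡∣p∣*∣q∣ v A) ⟩
    ∣ u ∣ * AD + ∣ v ∣ * A                 ≤⟨ +-mono-≤ (*-monoʳ-≤-nonNeg AD (<⇒≤ close-a+d))
                                                       (*-monoʳ-≤-nonNeg A (<⇒≤ close-a)) ⟩
    δ * AD + δ * A                         ≡⟨ *-distribˡ-+ δ AD A ⟨
    δ * (AD + A)                           ≡⟨ cong (δ *_) (ι-+ (suc a ℕ.+ suc d) (suc a)) ⟨
    δ * ι (suc a ℕ.+ suc d ℕ.+ suc a)      ≤⟨ *-monoˡ-≤-nonNeg δ (ι-mono-≤ (twice-plus-≤ c a≤cd)) ⟩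
    δ * ι ((2 ℕ.* c ℕ.+ 1) ℕ.* suc d)      ≡⟨ cong (δ *_) (ι-* (2 ℕ.* c ℕ.+ 1) (suc d)) ⟩
    δ * (ι (2 ℕ.* c ℕ.+ 1) * D)            ≡⟨ *-assoc δ _ D ⟨
    δ * ι (2 ℕ.* c ℕ.+ 1) * D              ∎)
    where
    open ≤-Reasoning
    A = ι (suc a)
    D = ι (suc d)
    AD = ι (suc a ℕ.+ suc d)
    u = frac (x ℕ.+ z) (suc a ℕ.+ suc d) - L
    v = frac x (suc a) - L
    instance
      δ-nonNeg : NonNegative δ
      δ-nonNeg = nonNegative (≤-trans (nonNegative⁻¹ ∣ v ∣ {{∣-∣-nonNeg v}}) (<⇒≤ close-a))

  ∃-margin-11 : ∀ {ε} → 0ℚ < ε → ∃[ δ ] 0ℚ < δ × δ * ι 11 < ε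
  ∃-margin-11 {ε} 0<ε = ε * twelfth , positive⁻¹ _ {{pos*pos⇒pos ε twelfth}} ,
    subst₂ _<_ (sym (*-assoc ε twelfth (ι 11))) (*-identityʳ ε)
      (*-monoʳ-<-pos ε (toWitness {a? = twelfth * ι 11 <? 1ℚ} _))
    where
    twelfth = + 1 / 12
    instance
      ε-pos : Positive ε
      ε-pos = positive 0<ε

module Integral where
  open import Data.Nat using (ℕ; zero; suc; _+_; _*_; _≤_; z≤n; s≤s)
  import Data.Nat.Properties as ℕ
  open import Data.Bool using (true; false; not)
  open import Data.List using (List; []; _∷_; _++_; length; replicate)
  import Data.List.Properties as List

  count₂ : List Letter → ℕ
  count₂ []      = 0
  count₂ (₁ ∷ v) = count₂ v
  count₂ (₂ ∷ v) = suc (count₂ v)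

  count₂-replicate₁-++ : ∀ n v → count₂ (replicate n ₁ ++ v) ≡ count₂ v
  count₂-replicate₁-++ zero    v = refl
  count₂-replicate₁-++ (suc n) v = count₂-replicate₁-++ n v

  count₂-replicate₂-++ : ∀ n v → count₂ (replicate n ₂ ++ v) ≡ n + count₂ v
  count₂-replicate₂-++ zero    v = refl
  count₂-replicate₂-++ (suc n) v = cong suc (count₂-replicate₂-++ n v)

  1≤val : ∀ a → 1 ≤ val a
  1≤val ₁ = s≤s z≤n
  1≤val ₂ = s≤s z≤n

  val≤2 : ∀ a → val a ≤ 2
  val≤2 ₁ = s≤s z≤n
  val≤2 ₂ = ℕ.≤-refl

  length-integAux-∷ : ∀ b a v → length (integAux b (a ∷ v)) ≡ val a + length (integAux (not b) v)
  length-integAux-∷ true  a v = trans (List.length-++ (replicate (val a) ₁))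
                                      (cong (_+ _) (List.length-replicate (val a)))
  length-integAux-∷ false a v = trans (List.length-++ (replicate (val a) ₂))
                                      (cong (_+ _) (List.length-replicate (val a)))

  length-integAux : ∀ b v → length (integAux b v) ≡ length v + count₂ v
  length-integAux b []      = refl
  length-integAux b (a ∷ v) = begin
    length (integAux b (a ∷ v))        ≡⟨ length-integAux-∷ b a v ⟩
    val a + length (integAux (not b) v) ≡⟨ cong (val a +_) (length-integAux (not b) v) ⟩
    val a + (length v + count₂ v)      ≡⟨ regroup a ⟩
    suc (length v + count₂ (a ∷ v))    ∎
    where
    open ≡-Reasoning
    regroup : ∀ a → val a + (length v + count₂ v) ≡ suc (length v + count₂ (a ∷ v))
    regroup ₁ = refl
    regroup ₂ = cong suc (sym (ℕ.+-suc (length v) (count₂ v)))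

  -- Each run of 2s pays for itself and the run of 1s after it; only the leading run of 1s
  -- (at most two letters) is unpaid.
  length-integAux-true-≤ : ∀ v → length (integAux true v) ≤ 3 * count₂ (integAux true v) + 2
  length-integAux-false-≤ : ∀ v → length (integAux false v) ≤ 3 * count₂ (integAux false v)

  length-integAux-true-≤ []      = z≤n
  length-integAux-true-≤ (a ∷ v) = begin
    length (integAux true (a ∷ v))      ≡⟨ length-integAux-∷ true a v ⟩
    val a + length (integAux false v)   ≤⟨ ℕ.+-mono-≤ (val≤2 a) (length-integAux-false-≤ v) ⟩
    2 + 3 * count₂ (integAux false v)   ≡⟨ ℕ.+-comm 2 _ ⟩
    3 * count₂ (integAux false v) + 2   ≡⟨ cong (λ c → 3 * c + 2) (count₂-replicate₁-++ (val a) _) ⟨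
    3 * count₂ (integAux true (a ∷ v)) + 2 ∎
    where open ℕ.≤-Reasoning

  length-integAux-false-≤ []      = z≤n
  length-integAux-false-≤ (a ∷ v) = begin
    length (integAux false (a ∷ v))     ≡⟨ length-integAux-∷ false a v ⟩
    val a + length (integAux true v)    ≤⟨ ℕ.+-monoʳ-≤ (val a) (length-integAux-true-≤ v) ⟩
    val a + (3 * c + 2)                 ≤⟨ absorb a ⟩
    3 * val a + 3 * c                   ≡⟨ ℕ.*-distribˡ-+ 3 (val a) c ⟨
    3 * (val a + c)                     ≡⟨ cong (3 *_) (count₂-replicate₂-++ (val a) _) ⟨
    3 * count₂ (integAux false (a ∷ v)) ∎
    where
    open ℕ.≤-Reasoning
    c = count₂ (integAux true v)
    absorb : ∀ a → val a + (3 * c + 2) ≤ 3 * val a + 3 * c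
    absorb ₁ = ℕ.≤-reflexive (cong suc (ℕ.+-comm (3 * c) 2))
    absorb ₂ = s≤s (s≤s (ℕ.≤-trans (ℕ.≤-reflexive (ℕ.+-comm (3 * c) 2)) (ℕ.m≤n+m (2 + 3 * c) 2)))

  1≤count₂-integ : ∀ v → 2 ≤ length v → 1 ≤ count₂ (integ v)
  1≤count₂-integ (a ∷ []) (s≤s ())
  1≤count₂-integ (a ∷ b ∷ v) _ = begin
    1                                          ≤⟨ 1≤val b ⟩
    val b                                      ≤⟨ ℕ.m≤m+n (val b) _ ⟩
    val b + count₂ (integAux true v)           ≡⟨ count₂-replicate₂-++ (val b) _ ⟨
    count₂ (integAux false (b ∷ v))            ≡⟨ count₂-replicate₁-++ (val a) _ ⟨
    count₂ (integ (a ∷ b ∷ v))                 ∎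
    where open ℕ.≤-Reasoning

  length-integ-≤ : ∀ v → 2 ≤ length v → length (integ v) ≤ 5 * count₂ (integ v)
  length-integ-≤ v 2≤|v| = begin
    length (integ v)       ≤⟨ length-integAux-true-≤ v ⟩
    3 * c + 2              ≤⟨ ℕ.+-monoʳ-≤ (3 * c) (ℕ.*-monoʳ-≤ 2 (1≤count₂-integ v 2≤|v|)) ⟩
    3 * c + 2 * c          ≡⟨ ℕ.*-distribʳ-+ c 3 2 ⟨
    5 * c                  ∎
    where
    open ℕ.≤-Reasoning
    c = count₂ (integ v)

module Factors where
  open import Data.Nat using (ℕ; zero; suc; _+_; _*_; _≤_)
  import Data.Nat.Properties as ℕ
  open import Data.List using (List; []; _∷_; _++_; length; drop; _∷ʳ_)
  import Data.List.Properties as List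
  import Data.Rational as ℚ
  open Frequency using (ι; frac-deviation-≤)

  factor : (ℕ → Letter) → ℕ → ℕ → List Letter
  factor S a zero    = []
  factor S a (suc d) = factor S a d ∷ʳ S (a + d)

  count₁-++ : ∀ u v → count₁ (u ++ v) ≡ count₁ u + count₁ v
  count₁-++ []      v = refl
  count₁-++ (₁ ∷ u) v = cong suc (count₁-++ u v)
  count₁-++ (₂ ∷ u) v = count₁-++ u v

  length-∷ʳ : ∀ {A : Set} (u : List A) x → length (u ∷ʳ x) ≡ suc (length u)
  length-∷ʳ u x = trans (List.length-++ u) (ℕ.+-comm _ 1)

  length-prefixOf : ∀ S n → length (prefixOf S n) ≡ n
  length-prefixOf S zero    = refl
  length-prefixOf S (suc n) = trans (length-∷ʳ (prefixOf S n) (S n)) (cong suc (length-prefixOf S n))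

  length-factor : ∀ S a d → length (factor S a d) ≡ d
  length-factor S a zero    = refl
  length-factor S a (suc d) = trans (length-∷ʳ (factor S a d) (S (a + d))) (cong suc (length-factor S a d))

  prefixOf-+ : ∀ S a d → prefixOf S (a + d) ≡ prefixOf S a ++ factor S a d
  prefixOf-+ S a zero    = trans (cong (prefixOf S) (ℕ.+-identityʳ a)) (sym (List.++-identityʳ _))
  prefixOf-+ S a (suc d) = begin
    prefixOf S (a + suc d)                     ≡⟨ cong (prefixOf S) (ℕ.+-suc a d) ⟩
    prefixOf S (a + d) ∷ʳ S (a + d)            ≡⟨ cong (_∷ʳ S (a + d)) (prefixOf-+ S a d) ⟩
    (prefixOf S a ++ factor S a d) ∷ʳ S (a + d) ≡⟨ List.++-assoc (prefixOf S a) (factor S a d) _ ⟩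
    prefixOf S a ++ factor S a (suc d)          ∎
    where open ≡-Reasoning

  drop-length-++ : ∀ {A : Set} (u v : List A) → drop (length u) (u ++ v) ≡ v
  drop-length-++ []      v = refl
  drop-length-++ (x ∷ u) v = drop-length-++ u v

  drop-prefixOf-+ : ∀ S a d → drop a (prefixOf S (a + d)) ≡ factor S a d
  drop-prefixOf-+ S a d = begin
    drop a (prefixOf S (a + d))    ≡⟨ cong (drop a) (prefixOf-+ S a d) ⟩
    drop a (p ++ factor S a d)     ≡⟨ cong (λ n → drop n (p ++ factor S a d)) (length-prefixOf S a) ⟨
    drop (length p) (p ++ factor S a d) ≡⟨ drop-length-++ p (factor S a d) ⟩
    factor S a d                   ∎
    where
    open ≡-Reasoning
    p = prefixOf S a

  factor-freq₁-deviation-≤ : ∀ S {a d L δ} c → 1 ≤ a → 1 ≤ d → a ≤ c * d →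
    ∣ freq₁ (prefixOf S (a + d)) - L ∣ < δ → ∣ freq₁ (prefixOf S a) - L ∣ < δ →
    ∣ freq₁ (factor S a d) - L ∣ ℚ.≤ δ ℚ.* ι (2 * c + 1)
  factor-freq₁-deviation-≤ S {a@(suc _)} {d@(suc _)} {L} {δ} c _ _ a≤cd close-a+d close-a =
    subst (λ f → ∣ f - L ∣ ℚ.≤ δ ℚ.* ι (2 * c + 1)) (sym freq-factor)
      (frac-deviation-≤ {count₁ (prefixOf S a)} {count₁ (factor S a d)} c a≤cd
        (subst (λ f → ∣ f - L ∣ < δ) freq-a+d close-a+d)
        (subst (λ f → ∣ f - L ∣ < δ) freq-a close-a))
    where
    freq-a : freq₁ (prefixOf S a) ≡ frac (count₁ (prefixOf S a)) a
    freq-a = cong (frac _) (length-prefixOf S a)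
    freq-a+d : freq₁ (prefixOf S (a + d)) ≡
               frac (count₁ (prefixOf S a) + count₁ (factor S a d)) (a + d)
    freq-a+d = cong₂ frac
      (trans (cong count₁ (prefixOf-+ S a d)) (count₁-++ (prefixOf S a) (factor S a d)))
      (length-prefixOf S (a + d))
    freq-factor : freq₁ (factor S a d) ≡ frac (count₁ (factor S a d)) d
    freq-factor = cong (frac _) (length-factor S a d)

module Blocks (S : ℕ → Letter) (S-kolakoski : IsKolakoski S)
              (w : List Letter) (2≤|w| : 2 ≤ length w) (w-prefix : IsPrefix w S) where
  open import Data.Nat using (zero; suc; _+_; z≤n; s≤s)
  import Data.Nat.Properties as ℕ
  open import Data.Bool using (true)
  open import Data.List using (drop)
  import Data.Rational as ℚ
  open Frequency using (ι)
  open Integral using (count₂; length-integAux; 1≤count₂-integ; length-integ-≤)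
  open Factors using (factor; drop-prefixOf-+; factor-freq₁-deviation-≤)

  ℓ : ℕ → ℕ
  ℓ k = length (integPow k w)

  integPow-prefix : ∀ k → IsPrefix (integPow k w) S
  integPow-prefix zero    = w-prefix
  integPow-prefix (suc k) =
    subst (λ v → IsPrefix (integ v) S) (sym (integPow-prefix k)) (S-kolakoski (ℓ k))

  ℓ-suc : ∀ k → ℓ (suc k) ≡ ℓ k + count₂ (integPow k w)
  ℓ-suc k = length-integAux true (integPow k w)

  ℓ≤ℓ-suc : ∀ k → ℓ k ≤ ℓ (suc k)
  ℓ≤ℓ-suc k = ℕ.≤-trans (ℕ.m≤m+n (ℓ k) _) (ℕ.≤-reflexive (sym (ℓ-suc k)))

  2≤ℓ : ∀ k → 2 ≤ ℓ k
  2≤ℓ zero    = 2≤|w|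
  2≤ℓ (suc k) = ℕ.≤-trans (2≤ℓ k) (ℓ≤ℓ-suc k)

  1≤count₂-integPow-suc : ∀ k → 1 ≤ count₂ (integPow (suc k) w)
  1≤count₂-integPow-suc k = 1≤count₂-integ (integPow k w) (2≤ℓ k)

  suc≤ℓ-suc : ∀ k → suc k ≤ ℓ (suc k)
  suc≤ℓ-suc zero    = ℕ.≤-trans (ℕ.n≤1+n 1) (2≤ℓ 1)
  suc≤ℓ-suc (suc k) = ℕ.≤-trans (ℕ.≤-reflexive (ℕ.+-comm 1 (suc k)))
    (ℕ.≤-trans (ℕ.+-mono-≤ (suc≤ℓ-suc k) (1≤count₂-integPow-suc k)) (ℕ.≤-reflexive (sym (ℓ-suc (suc k)))))

  block-factor : ∀ k → block w (suc k) ≡ factor S (ℓ k) (count₂ (integPow k w))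
  block-factor k = begin
    drop (ℓ k) (integPow (suc k) w)            ≡⟨ cong (drop (ℓ k)) (integPow-prefix (suc k)) ⟩
    drop (ℓ k) (prefixOf S (ℓ (suc k)))        ≡⟨ cong (λ n → drop (ℓ k) (prefixOf S n)) (ℓ-suc k) ⟩
    drop (ℓ k) (prefixOf S (ℓ k + count₂ (integPow k w))) ≡⟨ drop-prefixOf-+ S (ℓ k) _ ⟩
    factor S (ℓ k) (count₂ (integPow k w))     ∎
    where open ≡-Reasoning

  block-freq₁-deviation-≤ : ∀ {L δ} N → (∀ n → N ≤ n → 1 ≤ n → ∣ freq₁ (prefixOf S n) - L ∣ < δ) →
    ∀ k → 2 + N ≤ k → ∣ freq₁ (block w k) - L ∣ ℚ.≤ δ ℚ.* ι 11
  block-freq₁-deviation-≤ {L} {δ} N close (suc (suc j)) (s≤s (s≤s N≤j)) =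
    subst (λ b → ∣ freq₁ b - L ∣ ℚ.≤ δ ℚ.* ι 11) (sym (block-factor (suc j)))
      (factor-freq₁-deviation-≤ S 5 1≤a 1≤d (length-integ-≤ (integPow j w) (2≤ℓ j))
        (close (a + d) (ℕ.≤-trans N≤a (ℕ.m≤m+n a d)) (ℕ.≤-trans 1≤a (ℕ.m≤m+n a d)))
        (close a N≤a 1≤a))
    where
    a = ℓ (suc j)
    d = count₂ (integPow (suc j) w)
    N≤a : N ≤ a
    N≤a = ℕ.≤-trans N≤j (ℕ.≤-trans (ℕ.n≤1+n j) (suc≤ℓ-suc j))
    1≤a : 1 ≤ a
    1≤a = ℕ.≤-trans (s≤s z≤n) (suc≤ℓ-suc j)
    1≤d : 1 ≤ d
    1≤d = 1≤count₂-integPow-suc j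

lemma12 : (S : ℕ → Letter) → IsKolakoski S →
          (w : List Letter) → 2 ≤ length w → IsPrefix w S →
          FreqLimitExists S →
          ∀ (ε : ℚ) → 0ℚ < ε →
          ∃[ n ] ∃[ N ] (∀ k m → n ≤ k → 1 ≤ k → N ≤ m → 1 ≤ m →
            ∣ freq₁ (block w k) - freq₁ (prefixOf S m) ∣ < ε)
lemma12 S S-kolakoski w 2≤|w| w-prefix cauchy ε 0<ε with Frequency.∃-margin-11 0<ε
... | δ , 0<δ , 11δ<ε with cauchy δ 0<δ
... | N , cauchy-N = suc (suc N) , N , λ k m 2+N≤k _ N≤m 1≤m →
  ≤-<-trans (block-freq₁-deviation-≤ N (λ n N≤n 1≤n → cauchy-N n m N≤n N≤m 1≤n 1≤m) k 2+N≤k) 11δ<ε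
  where open Blocks S S-kolakoski w 2≤|w| w-prefix using (block-freq₁-deviation-≤)
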